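{- Let $f:\mathcal{G}\to\mathbb{R}$ be an edge reflection positive and multiplicative graph parameter, and let $d$ be the value of $f$ on the graph consisting of a single circle, where $d$ is a nonnegative integer. Let $t$ be an arbitrary edge coloring model with $d$ colors. Then for every $k\ge 0$ and every pair $H,K\in\mathcal{QM}_k$ we have $f(g(H,K))=t(g(H,K))$.
   Context: A graph is a finite multigraph in which loops and multiple edges are allowed and which may additionally contain circles, i.e. edges having no endpoints; $\mathcal{G}$ denotes the set of isomorphism classes of such graphs (including the empty graph $\emptyset$). A graph parameter $f$ is multiplicative if $f(G_1\cup G_2)=f(G_1)f(G_2)$ for disjoint unions and $f(\emptyset)=1$. $\mathcal{Q}$ is the real span of $\mathcal{G}$; parameters extend linearly. For $k\ge 0$, $\mathcal{G}_k$ is the set of graphs with $k$ open ends labelled $1,\dots,k$: a graph together with $k$ additional labelled points (open ends, not vertices), each incident with exactly one edge (an edge may join a vertex to an open end, or two open ends). $\mathcal{Q}_k$ is the real span of $\mathcal{G}_k$. The gluing $g(G_1,G_2)\in\mathcal{G}$ of $G_1,G_2\in\mathcal{G}_k$ is obtained by taking the disjoint union, identifying open ends with the same label, and replacing each identified point together with its two incident edges by a single edge joining their other ends (closed chains become circles); for $k=0$ it is disjoint union; it extends bilinearly to $\mathcal{Q}_k\times\mathcal{Q}_k\to\mathcal{Q}$. $f$ is edge reflection positive if $f(g(H,H))\ge0$ for all $k$ and $H\in\mathcal{Q}_k$. $\mathcal{QM}_k\subseteq\mathcal{Q}_k$ is the span of those graphs in $\mathcal{G}_k$ that have no vertices and no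 circles (i.e. whose edges form a perfect matching on the $k$ open ends). An edge coloring model with $d$ colors $c_1,\dots,c_d$ and values in a commutative $\mathbb{R}$-algebra $R$ with $1$ is a map $t:\mathbb{N}^d\to R$ ($\mathbb{N}=\{0,1,\dots\}$), with partition function $t(G)=\sum_{\psi:E(G)\to\{c_1,\dots,c_d\}}\prod_{v\in V(G)}t(v_\psi)$, where circles are colored too, $v_\psi$ counts the edges of each color at $v$ (loops twice), and the empty product is $1$; real numbers are regarded as elements of $R$ via $\lambda\mapsto\lambda\cdot 1$. -}

module Defs where

open import Level using (Level; 0ℓ; _⊔_) renaming (suc to lsuc)
open import Data.Nat using (ℕ; zero; suc) renaming (_+_ to _+ℕ_; _*_ to _*ℕ_)
open import Data.Fin using (Fin; zero; suc; _↑ˡ_; _↑ʳ_)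
import Data.Fin as Fin
open import Data.Sum using (_⊎_; inj₁; inj₂; [_,_])
import Data.Sum.Properties as SumP
open import Data.Product using (Σ; _×_; _,_; proj₁; proj₂)
open import Data.List using (List; []; _∷_; _++_; map; length; lookup; concatMap; foldr)
open import Data.List.Relation.Unary.All using (All)
open import Data.Maybe using (Maybe; just; nothing)
open import Relation.Nullary using (¬_; yes; no)
open import Relation.Binary.PropositionalEquality using (_≡_)
open import Relation.Binary.Structures using (IsTotalOrder)
open import Function.Bundles using (_↔_; Inverse)
open import Algebra.Bundles using (CommutativeRing)

-- The real numbers, axiomatised as a (Dedekind) complete ordered field.
-- (agda-stdlib has no reals; every such structure is isomorphic to ℝ.)

record RealField : Set₁ where
  field
    commutativeRing : CommutativeRing 0ℓ 0ℓ
  open CommutativeRing commutativeRing public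
  field
    _≤_          : Carrier → Carrier → Set
    isTotalOrder : IsTotalOrder _≈_ _≤_
    0≉1          : ¬ (0# ≈ 1#)
    inverse      : ∀ x → ¬ (x ≈ 0#) → Σ Carrier (λ y → (x * y) ≈ 1#)
    +-mono-≤     : ∀ x y z → x ≤ y → (x + z) ≤ (y + z)
    *-nonneg     : ∀ x y → 0# ≤ x → 0# ≤ y → 0# ≤ (x * y)
    complete     : (P : Carrier → Set) → Σ Carrier P →
                   Σ Carrier (λ b → ∀ x → P x → x ≤ b) →
                   Σ Carrier (λ s → (∀ x → P x → x ≤ s) ×
                                    (∀ b → (∀ x → P x → x ≤ b) → s ≤ b))

module _ (ℝ : RealField) where
  open RealField ℝ
  fromℕ : ℕ → Carrier
  fromℕ zero    = 0#
  fromℕ (suc n) = 1# + fromℕ n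

record RAlgebra (ℝ : RealField) (c ℓ : Level) : Set (lsuc (c ⊔ ℓ)) where
  module ℝ = RealField ℝ
  field
    algRing : CommutativeRing c ℓ
  open CommutativeRing algRing public
  field
    _·_      : ℝ.Carrier → Carrier → Carrier
    ·-cong   : ∀ {a b x y} → a ℝ.≈ b → x ≈ y → (a · x) ≈ (b · y)
    ·-distʳ  : ∀ a b x → ((a ℝ.+ b) · x) ≈ ((a · x) + (b · x))
    ·-distˡ  : ∀ a x y → (a · (x + y)) ≈ ((a · x) + (a · y))
    ·-assoc  : ∀ a b x → ((a ℝ.* b) · x) ≈ (a · (b · x))
    ·-identity : ∀ x → (ℝ.1# · x) ≈ x
    ·-*-assoc  : ∀ a x y → ((a · x) * y) ≈ (a · (x * y))
  embed : ℝ.Carrier → Carrier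
  embed a = a · 1#

-- Graphs: vertices Fin nV, edges as (unordered) pairs of vertices
-- (loops and multiple edges allowed), and nC circles.

record Graph : Set where
  constructor mkGraph
  field
    nV    : ℕ
    edges : List (Fin nV × Fin nV)
    nC    : ℕ

open Graph public

SameEdge : {A : Set} → A × A → A × A → Set
SameEdge (a , b) (c , d) = ((a ≡ c) × (b ≡ d)) ⊎ ((a ≡ d) × (b ≡ c))

mapPair : {A B : Set} → (A → B) → A × A → B × B
mapPair f (a , b) = f a , f b

Iso : Graph → Graph → Set
Iso G H =
  Σ (Fin (nV G) ↔ Fin (nV H)) λ π →
  Σ (Fin (length (edges G)) ↔ Fin (length (edges H))) λ σ →
    (∀ e → SameEdge (lookup (edges H) (Inverse.to σ e))
                    (mapPair (Inverse.to π) (lookup (edges G) e)))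
    × (nC G ≡ nC H)

emptyGraph : Graph
emptyGraph = mkGraph 0 [] 0

circleGraph : Graph
circleGraph = mkGraph 0 [] 1

_⊍_ : Graph → Graph → Graph
G ⊍ H = mkGraph (nV G +ℕ nV H)
  (map (mapPair (_↑ˡ nV H)) (edges G) ++ map (mapPair (nV G ↑ʳ_)) (edges H))
  (nC G +ℕ nC H)

End : ℕ → ℕ → Set
End n k = Fin n ⊎ Fin k

eqInd : {n k : ℕ} → End n k → End n k → ℕ
eqInd x y with SumP.≡-dec Fin._≟_ Fin._≟_ x y
... | yes _ = 1
... | no  _ = 0

degEnd : {n k : ℕ} → List (End n k × End n k) → End n k → ℕ
degEnd []             x = 0
degEnd ((a , b) ∷ es) x = eqInd a x +ℕ eqInd b x +ℕ degEnd es x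

record GraphK (k : ℕ) : Set where
  constructor mkGraphK
  field
    nVk      : ℕ
    edgesk   : List (End nVk k × End nVk k)
    nCk      : ℕ
    openEnds : ∀ (i : Fin k) → degEnd edgesk (inj₂ i) ≡ 1

open GraphK public

-- gluing: identify the open ends, then suppress each identified point
-- (a point of degree 2) one at a time.

lowerEnd : {n p : ℕ} → End n (suc p) → Maybe (End n p)
lowerEnd (inj₁ v)       = just (inj₁ v)
lowerEnd (inj₂ zero)    = nothing
lowerEnd (inj₂ (suc i)) = just (inj₂ i)

restEdges : {n p : ℕ} → List (End n (suc p) × End n (suc p)) → List (End n p × End n p)
restEdges [] = []
restEdges ((a , b) ∷ es) with lowerEnd a | lowerEnd b
... | just x | just y = (x , y) ∷ restEdges es
... | _      | _      = restEdges es

-- other ends of the edges touching point 0 (nothing: a loop at point 0)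
otherEnds : {n p : ℕ} → List (End n (suc p) × End n (suc p)) → List (Maybe (End n p))
otherEnds [] = []
otherEnds ((a , b) ∷ es) with lowerEnd a | lowerEnd b
... | just _  | just _  = otherEnds es
... | nothing | just y  = just y ∷ otherEnds es
... | just x  | nothing = just x ∷ otherEnds es
... | nothing | nothing = nothing ∷ otherEnds es

suppress : {n : ℕ} (p : ℕ) → List (End n p × End n p) → ℕ → List (Fin n × Fin n) × ℕ
suppress zero es c = map (mapPair [ (λ v → v) , (λ ()) ]) es , c
suppress (suc p) es c with otherEnds es
... | nothing ∷ []          = suppress p (restEdges es) (suc c)
... | just x ∷ just y ∷ []  = suppress p ((x , y) ∷ restEdges es) c
... | _                     = suppress p (restEdges es) c   -- never occurs for gluings

glue : {k : ℕ} → GraphK k → GraphK k → Graph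
glue {k} G H =
  mkGraph n (proj₁ result) (proj₂ result)
  where
  n = nVk G +ℕ nVk H
  emb₁ : End (nVk G) k → End n k
  emb₁ = [ (λ v → inj₁ (v ↑ˡ nVk H)) , inj₂ ]
  emb₂ : End (nVk H) k → End n k
  emb₂ = [ (λ v → inj₁ (nVk G ↑ʳ v)) , inj₂ ]
  result = suppress k (map (mapPair emb₁) (edgesk G) ++ map (mapPair emb₂) (edgesk H))
                      (nCk G +ℕ nCk H)

module Quantum (ℝ : RealField) where
  open RealField ℝ

  Q : Set
  Q = List (Carrier × Graph)

  Qk : ℕ → Set
  Qk k = List (Carrier × GraphK k)

  evalQ : (Graph → Carrier) → Q → Carrier
  evalQ f = foldr (λ aG acc → (proj₁ aG * f (proj₂ aG)) + acc) 0#

  glueQ : {k : ℕ} → Qk k → Qk k → Q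
  glueQ H K = concatMap (λ aG → map (λ bH → (proj₁ aG * proj₁ bH) , glue (proj₂ aG) (proj₂ bH)) K) H

  -- graphs with no vertices and no circles (perfect matchings on the open ends)
  IsMatching : {k : ℕ} → GraphK k → Set
  IsMatching G = (nVk G ≡ 0) × (nCk G ≡ 0)

  InQM : {k : ℕ} → Qk k → Set
  InQM H = All (λ aG → IsMatching (proj₂ aG)) H

  Multiplicative : (Graph → Carrier) → Set
  Multiplicative f = (f emptyGraph ≈ 1#) × (∀ G H → f (G ⊍ H) ≈ (f G * f H))

  EdgeReflectionPositive : (Graph → Carrier) → Set
  EdgeReflectionPositive f = ∀ (k : ℕ) (H : Qk k) → 0# ≤ evalQ f (glueQ H H)

  IsoInvariant : (Graph → Carrier) → Set
  IsoInvariant f = ∀ G H → Iso G H → f G ≈ f H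

module EdgeColoring {ℝ : RealField} {c ℓ : Level} (R : RAlgebra ℝ c ℓ) where
  open RAlgebra R using (Carrier; _+_; _*_; 0#; 1#; _·_)
  module ℝ = RealField ℝ

  sumFin : (m : ℕ) → (Fin m → Carrier) → Carrier
  sumFin zero    F = 0#
  sumFin (suc m) F = F zero + sumFin m (λ i → F (suc i))

  prodFin : (m : ℕ) → (Fin m → Carrier) → Carrier
  prodFin zero    F = 1#
  prodFin (suc m) F = F zero * prodFin m (λ i → F (suc i))

  consF : {d m : ℕ} → Fin d → (Fin m → Fin d) → Fin (suc m) → Fin d
  consF x ψ zero    = x
  consF x ψ (suc i) = ψ i

  sumMaps : (d m : ℕ) → ((Fin m → Fin d) → Carrier) → Carrier
  sumMaps d zero    F = F (λ ())
  sumMaps d (suc m) F = sumFin d (λ x → sumMaps d m (λ ψ → F (consF x ψ)))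

  eqF : {n : ℕ} → Fin n → Fin n → ℕ
  eqF x y with x Fin.≟ y
  ... | yes _ = 1
  ... | no  _ = 0

  colDeg : {n d : ℕ} (es : List (Fin n × Fin n)) → (Fin (length es) → Fin d) →
           Fin n → Fin d → ℕ
  colDeg []             ψ v col = 0
  colDeg ((a , b) ∷ es) ψ v col =
    eqF (ψ zero) col *ℕ (eqF a v +ℕ eqF b v) +ℕ colDeg es (λ i → ψ (suc i)) v col

  partition : (d : ℕ) → ((Fin d → ℕ) → Carrier) → Graph → Carrier
  partition d t G =
    sumMaps d (length (edges G)) λ ψ →
    sumMaps d (nC G) λ χ →
    prodFin (nV G) λ v → t (colDeg (edges G) ψ v)

  partitionQ : (d : ℕ) → ((Fin d → ℕ) → Carrier) → List (ℝ.Carrier × Graph) → Carrier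
  partitionQ d t = foldr (λ aG acc → (proj₁ aG · partition d t (proj₂ aG)) + acc) 0#

{-# OPTIONS --safe #-}
-- Gluing two perfect matchings produces a graph with no vertices, i.e. a disjoint
-- union of n circles. A multiplicative f takes the value d ^ n on it, and an edge
-- coloring model with d colours also gives d ^ n (every colouring of the circles has
-- empty vertex product). Both sides are linear, so they agree on glueQ H K.
module Submission where

open import Defs
open import Level using (Level)
open import Function using (_∘_)
open import Data.Nat using (ℕ; zero; suc)
open import Data.Fin using (Fin)
open import Data.Product using (_,_; proj₁; proj₂)
open import Data.List using ([]; _∷_)
open import Data.List.Relation.Unary.All using (All; []; _∷_)
import Data.List.Relation.Unary.All as All
open import Data.List.Relation.Unary.All.Properties using (concat⁺; map⁺)
open import Relation.Binary.PropositionalEquality as ≡ using (_≡_; cong₂)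
import Relation.Binary.Reasoning.Setoid as SetoidReasoning
import Algebra.Properties.Ring as RingProperties

VertexFree : Graph → Set
VertexFree G = nV G ≡ 0

circles : ℕ → Graph
circles n = mkGraph 0 [] n

vertexFree⇒circles : ∀ G → VertexFree G → G ≡ circles (nC G)
vertexFree⇒circles (mkGraph _ []            _) ≡.refl = ≡.refl
vertexFree⇒circles (mkGraph _ ((() , _) ∷ _) _) ≡.refl

module _ (ℝ : RealField) where
  open Quantum ℝ

  glueQ-vertexFree : ∀ {k} {H K : Qk k} → InQM H → InQM K →
                     All (VertexFree ∘ proj₂) (glueQ H K)
  glueQ-vertexFree pH pK =
    concat⁺ (map⁺ (All.map (λ (noVₕ , _) →
      map⁺ (All.map (λ (noVₖ , _) → cong₂ Data.Nat._+_ noVₕ noVₖ) pK)) pH))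

module _ {ℝ : RealField} {c ℓ : Level} (R : RAlgebra ℝ c ℓ) where
  open RAlgebra R
  open RingProperties ring using (x+x≈x⇒x≈0)
  open SetoidReasoning setoid
  open EdgeColoring R hiding (module ℝ)

  embed-+ : ∀ a b → embed (a ℝ.+ b) ≈ embed a + embed b
  embed-+ a b = ·-distʳ a b 1#

  embed-* : ∀ a b → embed (a ℝ.* b) ≈ embed a * embed b
  embed-* a b = begin
    (a ℝ.* b) · 1#       ≈⟨ ·-assoc a b 1# ⟩
    a · (b · 1#)         ≈⟨ ·-cong ℝ.refl (*-identityˡ _) ⟨
    a · (1# * (b · 1#))  ≈⟨ ·-*-assoc a 1# _ ⟨
    (a · 1#) * (b · 1#)  ∎

  embed-0# : embed ℝ.0# ≈ 0#
  embed-0# = x+x≈x⇒x≈0 (embed ℝ.0#) (begin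
    embed ℝ.0# + embed ℝ.0#  ≈⟨ embed-+ ℝ.0# ℝ.0# ⟨
    embed (ℝ.0# ℝ.+ ℝ.0#)    ≈⟨ ·-cong (ℝ.+-identityʳ ℝ.0#) refl ⟩
    embed ℝ.0#               ∎)

  embed-1# : embed ℝ.1# ≈ 1#
  embed-1# = ·-identity 1#

  sumFin-const : ∀ d S → sumFin d (λ _ → S) ≈ embed (fromℕ ℝ d) * S
  sumFin-const zero S = begin
    0#               ≈⟨ zeroˡ S ⟨
    0# * S           ≈⟨ *-congʳ embed-0# ⟨
    embed ℝ.0# * S   ∎
  sumFin-const (suc d) S = begin
    S + sumFin d (λ _ → S)                    ≈⟨ +-cong (sym (*-identityˡ S)) (sumFin-const d S) ⟩
    1# * S + embed (fromℕ ℝ d) * S            ≈⟨ distribʳ S 1# _ ⟨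
    (1# + embed (fromℕ ℝ d)) * S              ≈⟨ *-congʳ (+-congʳ embed-1#) ⟨
    (embed ℝ.1# + embed (fromℕ ℝ d)) * S      ≈⟨ *-congʳ (embed-+ ℝ.1# (fromℕ ℝ d)) ⟨
    embed (fromℕ ℝ (suc d)) * S               ∎

  embed-evalQ : ∀ (f : Graph → ℝ.Carrier) d t (L : Quantum.Q ℝ) →
                All (λ (_ , G) → embed (f G) ≈ partition d t G) L →
                embed (Quantum.evalQ ℝ f L) ≈ partitionQ d t L
  embed-evalQ f d t [] [] = embed-0#
  embed-evalQ f d t ((a , G) ∷ L) (fG≈tG ∷ rest) = begin
    embed (a ℝ.* f G ℝ.+ Quantum.evalQ ℝ f L)          ≈⟨ embed-+ _ _ ⟩
    (a ℝ.* f G) · 1# + embed (Quantum.evalQ ℝ f L)     ≈⟨ +-cong (·-assoc a (f G) 1#) (embed-evalQ f d t L rest) ⟩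
    a · embed (f G) + partitionQ d t L                 ≈⟨ +-congʳ (·-cong ℝ.refl fG≈tG) ⟩
    a · partition d t G + partitionQ d t L             ∎

  module _ (f : Graph → ℝ.Carrier) (mult : Quantum.Multiplicative ℝ f)
           (d : ℕ) (f-circle : f circleGraph ℝ.≈ fromℕ ℝ d) (t : (Fin d → ℕ) → Carrier) where

    embed-f≈partition-circles : ∀ n → embed (f (circles n)) ≈ partition d t (circles n)
    embed-f≈partition-circles zero = begin
      embed (f emptyGraph)  ≈⟨ ·-cong (proj₁ mult) refl ⟩
      embed ℝ.1#            ≈⟨ embed-1# ⟩
      1#                    ∎
    embed-f≈partition-circles (suc n) = begin
      embed (f (circleGraph ⊍ circles n))                ≈⟨ ·-cong (proj₂ mult circleGraph (circles n)) refl ⟩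
      embed (f circleGraph ℝ.* f (circles n))            ≈⟨ embed-* _ _ ⟩
      embed (f circleGraph) * embed (f (circles n))      ≈⟨ *-cong (·-cong f-circle refl) (embed-f≈partition-circles n) ⟩
      embed (fromℕ ℝ d) * partition d t (circles n)      ≈⟨ sumFin-const d _ ⟨
      partition d t (circles (suc n))                    ∎

    embed-f≈partition-vertexFree : ∀ G → VertexFree G → embed (f G) ≈ partition d t G
    embed-f≈partition-vertexFree G noV with ≡.refl ← vertexFree⇒circles G noV =
      embed-f≈partition-circles (nC G)

lemma2 : (ℝ : RealField) → let open RealField ℝ in let open Quantum ℝ in
    (f : Graph → Carrier) → IsoInvariant f → Multiplicative f → EdgeReflectionPositive f →
    (d : ℕ) → f circleGraph ≈ fromℕ ℝ d →
    {c ℓ : Level} (R : RAlgebra ℝ c ℓ) (t : (Fin d → ℕ) → RAlgebra.Carrier R) →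
    (k : ℕ) (H K : Qk k) → InQM H → InQM K →
    RAlgebra._≈_ R (RAlgebra.embed R (evalQ f (glueQ H K))) (EdgeColoring.partitionQ R d t (glueQ H K))
lemma2 ℝ f _ mult _ d f-circle R t k H K pH pK =
  embed-evalQ R f d t (Quantum.glueQ ℝ H K)
    (All.map (λ {(_ , G)} → embed-f≈partition-vertexFree R f mult d f-circle t G)
             (glueQ-vertexFree ℝ pH pK))
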